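{- Let $k,t,p,q$ be positive integers with $k \geq 2t$, $1 \leq p \leq 2t-1$ and $1 \leq q \leq k-2t+1$. Then $C_{p,q}$ is a submatrix of $A_{k,t}$.
   Context: For positive integers $k,t$ with $k\ge t$, $A_{k,t}$ is the $0,1$-matrix of size $\binom{k}{t}\times\binom{k}{t}$ whose rows and columns are indexed by all $t$-element subsets of $[k]=\{1,\dots,k\}$, with entry $1$ in row $x$, column $y$ if and only if $x\cap y\neq\emptyset$. For integers $p\ge 1$, $q\ge 0$ and $n=p+q$, $C_{p,q}$ is the $n\times n$ circulant $0,1$-matrix whose first column consists of $p$ ones followed by $q$ zeros and each subsequent column is the cyclic downward shift by one of the previous column; i.e. (indices $1,\dots,n$) the entry in row $i$, column $j$ is $1$ iff $(i-j) \bmod n \in\{0,1,\dots,p-1\}$. An $n\times m$ $0,1$-matrix $M$ is a submatrix of $A_{k,t}$ if there are distinct $t$-subsets $F_1,\dots,F_n$ of $[k]$ and distinct $t$-subsets $G_1,\dots,G_m$ of $[k]$ with $M_{ij}=1$ iff $F_i\cap G_j\ne\emptyset$. -}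

module Defs where

open import Data.Nat using (ℕ; _+_; _∸_; _<_; _≤_)
open import Data.Sum using (_⊎_)
open import Data.Fin using (Fin; toℕ)
open import Data.Fin.Subset using (Subset; ∣_∣; _∩_; Nonempty)
open import Data.Product using (Σ; _×_)
open import Function.Definitions using (Injective)
open import Relation.Binary.PropositionalEquality using (_≡_)
open import Function.Bundles using (_⇔_)

-- A 0,1-matrix of size n × m, entries as propositions (entry is 1 iff the proposition holds).
-- Entry (i,j) of C_{p,q} with n = p + q (0-based indices; shift-invariant so same as 1-based):
-- 1 iff (i - j) mod n ∈ {0,…,p-1}.
-- written without _%_: since 0 ≤ i, j < n, (i - j) mod n is i - j if j ≤ i, and i + n - j otherwise.
C : (p q : ℕ) → Fin (p + q) → Fin (p + q) → Set
C p q i j = (toℕ j ≤ toℕ i × toℕ i ∸ toℕ j < p) ⊎ (toℕ i < toℕ j × (toℕ i + (p + q)) ∸ toℕ j < p)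

IsTSubset : (k t : ℕ) → Subset k → Set
IsTSubset k t F = ∣ F ∣ ≡ t

IsSubmatrixOfA : (k t n m : ℕ) → (Fin n → Fin m → Set) → Set
IsSubmatrixOfA k t n m M =
  Σ (Fin n → Subset k) λ F → Σ (Fin m → Subset k) λ G →
    ((∀ i → IsTSubset k t (F i)) × Injective _≡_ _≡_ F) ×
    ((∀ j → IsTSubset k t (G j)) × Injective _≡_ _≡_ G) ×
    (∀ i j → M i j ⇔ Nonempty (F i ∩ G j))

module Submission where

-- Put n = p + q points on a cycle, identified with Fin n, and write p = a + b + 1
-- with a, b ≤ t - 1.  Row i gets the arc of a + 1 points ending at i, column j the arc of
-- b + 1 points starting at j.  These arcs meet iff i lies at most a + b steps after j, i.e.
-- iff (i - j) mod n < p, which is exactly the entry C_{p,q}(i, j).  As q ≥ 1, no arc is the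
-- whole cycle, so an arc determines its end points and both families are injective.
-- Finally every row set gets t - 1 - a and every column set t - 1 - b private extra points,
-- making all sizes t; altogether q + 2t - 1 ≤ k points are used.

open import Defs
open import Data.Nat using (ℕ; suc; _+_; _*_; _∸_; _≤_)
open import Data.Nat
  using (zero; pred; _<_; _≤?_; _<?_; z≤n; s≤s; s≤s⁻¹; z<s; NonZero; >-nonZero⁻¹)
open import Data.Nat.Properties
open import Data.Nat.DivMod using (_%_; _mod_; [m+n]%n≡m%n; m<n⇒m%n≡m; %-distribˡ-+; m%n%n≡m%n)
open import Data.Nat.Tactic.RingSolver using (solve-∀)
open import Data.Bool using (Bool; true; false; _∧_)
open import Data.Empty using (⊥-elim)
open import Data.Product using (Σ; ∃₂; _×_; _,_; proj₁; proj₂)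
open import Data.Sum using (inj₁; inj₂)
open import Data.Fin using (Fin; zero; suc; toℕ; opposite; _↑ˡ_)
open import Data.Fin.Properties using (toℕ-injective; toℕ<n; toℕ-fromℕ<; opposite-prop; opposite-involutive)
open import Data.Fin.Subset using (Subset; ∣_∣; _∩_; _∈_; Nonempty; Empty)
open import Data.Fin.Subset.Properties using (x∈p∩q⁺; x∈p∩q⁻)
open import Data.Fin.Permutation using (Permutation′; permutation; _⟨$⟩ʳ_)
open import Data.Vec using (_∷_; []; _++_; tabulate; lookup; here; there)
open import Data.Vec.Properties using (lookup∘tabulate; []=⇒lookup; lookup⇒[]=; ++-injectiveˡ; zipWith-++)
open import Algebra.Properties.CommutativeMonoid.Sum +-0-commutativeMonoid using (sum; sum-permute)
open import Function using (_∘_; _⇔_; mk⇔; Equivalence)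
open import Function.Definitions using (Injective)
open import Function.Construct.Composition using (_⇔-∘_)
open import Function.Construct.Symmetry using (⇔-sym)
open import Level using (0ℓ)
open import Relation.Unary using (Pred; Decidable)
open import Relation.Nullary using (Dec; does; yes; no)
open import Relation.Binary.PropositionalEquality
  using (_≡_; refl; sym; trans; cong; cong₂; subst; module ≡-Reasoning)

private variable
  k n m r s s′ t t′ : ℕ

splitBelow : ∀ {c} a b → c ≤ a + b → ∃₂ λ u v → u ≤ a × v ≤ b × u + v ≡ c
splitBelow {c} a b c≤a+b with c ≤? a
... | yes c≤a = c , 0 , c≤a , z≤n , +-identityʳ c
... | no c≰a  = a , c ∸ a , ≤-refl , m≤n+o⇒m∸n≤o c a c≤a+b , m+[n∸m]≡n (≰⇒≥ c≰a)

⟦_⟧ : {P : Pred (Fin n) 0ℓ} → Decidable P → Subset n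
⟦ P? ⟧ = tabulate (does ∘ P?)

∈⟦⟧ : {P : Pred (Fin n) 0ℓ} (P? : Decidable P) (x : Fin n) → x ∈ ⟦ P? ⟧ ⇔ P x
∈⟦⟧ {P = P} P? x = mk⇔ (witness (P? x) ∘ lookup-true) (lookup⇒[]= x ⟦ P? ⟧ ∘ true-lookup)
  where
  lookup-true : x ∈ ⟦ P? ⟧ → does (P? x) ≡ true
  lookup-true x∈ = trans (sym (lookup∘tabulate (does ∘ P?) x)) ([]=⇒lookup x∈)
  witness : (d : Dec (P x)) → does d ≡ true → P x
  witness (yes px) _ = px
  true-lookup : P x → lookup ⟦ P? ⟧ x ≡ true
  true-lookup px = trans (lookup∘tabulate (does ∘ P?) x) (holds (P? x))
    where
    holds : (d : Dec (P x)) → does d ≡ true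
    holds (yes _)  = refl
    holds (no ¬px) = ⊥-elim (¬px px)

⟦⟧-⊆ : {P Q : Pred (Fin n) 0ℓ} (P? : Decidable P) (Q? : Decidable Q) →
       ⟦ P? ⟧ ≡ ⟦ Q? ⟧ → ∀ x → P x → Q x
⟦⟧-⊆ P? Q? same x =
  Equivalence.to (∈⟦⟧ Q? x) ∘ subst (x ∈_) same ∘ Equivalence.from (∈⟦⟧ P? x)

weight : Bool → ℕ
weight true  = 1
weight false = 0

∣tabulate∣≡sum : (f : Fin n → Bool) → ∣ tabulate f ∣ ≡ sum (weight ∘ f)
∣tabulate∣≡sum {zero}  f = refl
∣tabulate∣≡sum {suc n} f with f zero
... | true  = cong suc (∣tabulate∣≡sum (f ∘ suc))
... | false = ∣tabulate∣≡sum (f ∘ suc)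

∣tabulate∣-permute : (f : Fin n → Bool) (π : Permutation′ n) →
                     ∣ tabulate (f ∘ (π ⟨$⟩ʳ_)) ∣ ≡ ∣ tabulate f ∣
∣tabulate∣-permute f π = trans (∣tabulate∣≡sum (f ∘ (π ⟨$⟩ʳ_)))
  (trans (sym (sum-permute (weight ∘ f) π)) (sym (∣tabulate∣≡sum f)))

∣⟦<⟧∣ : ∀ {c} → c ≤ n → ∣ ⟦ (λ (x : Fin n) → toℕ x <? c) ⟧ ∣ ≡ c
∣⟦<⟧∣ {zero}          z≤n       = refl
∣⟦<⟧∣ {suc n} {zero}  z≤n       = ∣⟦<⟧∣ {n} z≤n
∣⟦<⟧∣ {suc n} {suc c} (s≤s c≤n) = cong suc (∣⟦<⟧∣ c≤n)

disjointBlocks : ∀ {e₁ e₂} → e₁ + e₂ ≤ r →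
                 Σ (Subset r) λ P → Σ (Subset r) λ Q → ∣ P ∣ ≡ e₁ × ∣ Q ∣ ≡ e₂ × Empty (P ∩ Q)
disjointBlocks {r} {e₁} {e₂} e₁+e₂≤r =
  first , last , ∣⟦<⟧∣ e₁≤r , trans (∣tabulate∣-permute _ reverse) (∣⟦<⟧∣ e₂≤r) , disjoint
  where
  e₁≤r = m+n≤o⇒m≤o e₁ e₁+e₂≤r
  e₂≤r = m+n≤o⇒m≤o e₂ (subst (_≤ r) (+-comm e₁ e₂) e₁+e₂≤r)
  reverse : Permutation′ r
  reverse = permutation opposite opposite opposite-involutive opposite-involutive
  inFirst : Decidable (λ (x : Fin r) → toℕ x < e₁)
  inFirst x = toℕ x <? e₁
  inLast : Decidable (λ (x : Fin r) → toℕ (opposite x) < e₂)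
  inLast x = toℕ (opposite x) <? e₂
  first last : Subset r
  first = ⟦ inFirst ⟧
  last  = ⟦ inLast ⟧
  disjoint : Empty (first ∩ last)
  disjoint (x , x∈) = <⇒≱ r<e₂+e₁ (subst (_≤ r) (+-comm e₁ e₂) e₁+e₂≤r)
    where
    x<e₁ : toℕ x < e₁
    x<e₁ = Equivalence.to (∈⟦⟧ inFirst x) (proj₁ (x∈p∩q⁻ first last x∈))
    rest<e₂ : r ∸ suc (toℕ x) < e₂
    rest<e₂ = subst (_< e₂) (opposite-prop x)
                (Equivalence.to (∈⟦⟧ inLast x) (proj₂ (x∈p∩q⁻ first last x∈)))
    r<e₂+e₁ : r < e₂ + e₁
    r<e₂+e₁ = subst (_< e₂ + e₁) (m∸n+n≡m (toℕ<n x)) (+-mono-<-≤ rest<e₂ x<e₁)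

∣++∣ : (p : Subset m) (q : Subset r) → ∣ p ++ q ∣ ≡ ∣ p ∣ + ∣ q ∣
∣++∣ []          q = refl
∣++∣ (true ∷ p)  q = cong suc (∣++∣ p q)
∣++∣ (false ∷ p) q = ∣++∣ p q

Nonempty-++ : (p : Subset m) {q : Subset r} → Empty q → Nonempty (p ++ q) ⇔ Nonempty p
Nonempty-++ {r = r} p {q} q-empty = mk⇔ (restrict p) (λ (x , x∈p) → x ↑ˡ r , extend x∈p)
  where
  restrict : (p : Subset m) → Nonempty (p ++ q) → Nonempty p
  restrict []      (y , y∈q)           = ⊥-elim (q-empty (y , y∈q))
  restrict (s ∷ p) (zero  , here)      = zero , here
  restrict (s ∷ p) (suc y , there y∈)  with restrict p (y , y∈)
  ... | x , x∈p = suc x , there x∈p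
  extend : ∀ {m} {p : Subset m} {x} → x ∈ p → (x ↑ˡ r) ∈ p ++ q
  extend here       = here
  extend (there x∈) = there (extend x∈)

-- IsSubmatrixOfA k t n m M is, by definition, Realization k n m M t t.
Realization : (k n m : ℕ) → (Fin n → Fin m → Set) → (s s′ : ℕ) → Set
Realization k n m M s s′ =
  Σ (Fin n → Subset k) λ F → Σ (Fin m → Subset k) λ G →
    ((∀ i → ∣ F i ∣ ≡ s) × Injective _≡_ _≡_ F) ×
    ((∀ j → ∣ G j ∣ ≡ s′) × Injective _≡_ _≡_ G) ×
    (∀ i j → M i j ⇔ Nonempty (F i ∩ G j))

Realization-cong : {M M′ : Fin n → Fin m → Set} → (∀ i j → M′ i j ⇔ M i j) →
                   Realization k n m M s s′ → Realization k n m M′ s s′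
Realization-cong M′⇔M (F , G , Fs , Gs , intersects) =
  F , G , Fs , Gs , λ i j → intersects i j ⇔-∘ M′⇔M i j

-- Padding: enlarging the ground set by r points and adding e₁ private points to every
-- F i and e₂ private points to every G j keeps the intersection pattern.
pad : ∀ {e₁ e₂} {M : Fin n → Fin m → Set} → e₁ + e₂ ≤ r → s + e₁ ≡ t → s′ + e₂ ≡ t′ →
      Realization k n m M s s′ → Realization (k + r) n m M t t′
pad {r = r} e₁+e₂≤r s+e₁≡t s′+e₂≡t′ (F , G , (∣F∣ , F-inj) , (∣G∣ , G-inj) , intersects)
  with disjointBlocks e₁+e₂≤r
... | P , Q , ∣P∣ , ∣Q∣ , disjoint =
  (λ i → F i ++ P) , (λ j → G j ++ Q) ,
  ((λ i → size (F i) P (∣F∣ i) ∣P∣ s+e₁≡t) , F-inj ∘ ++-injectiveˡ _ _) ,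
  ((λ j → size (G j) Q (∣G∣ j) ∣Q∣ s′+e₂≡t′) , G-inj ∘ ++-injectiveˡ _ _) ,
  λ i j → meets (F i) (G j) ⇔-∘ intersects i j
  where
  size : ∀ {a b c} (X : Subset _) (Y : Subset r) →
         ∣ X ∣ ≡ a → ∣ Y ∣ ≡ b → a + b ≡ c → ∣ X ++ Y ∣ ≡ c
  size X Y refl refl a+b≡c = trans (∣++∣ X Y) a+b≡c
  meets : (X Y : Subset _) → Nonempty (X ∩ Y) ⇔ Nonempty ((X ++ P) ∩ (Y ++ Q))
  meets X Y = subst (λ Z → Nonempty (X ∩ Y) ⇔ Nonempty Z) (sym (zipWith-++ _∧_ X P Y Q))
                    (⇔-sym (Nonempty-++ (X ∩ Y) disjoint))

-- The n-cycle: its points are the residues Fin n, and ℕ acts on them by rotation.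
module Cyclic (n : ℕ) {{_ : NonZero n}} where
  open ≡-Reasoning

  infixl 6 _⊕_ _⊖_

  _⊕_ : Fin n → ℕ → Fin n
  j ⊕ r = (toℕ j + r) mod n

  toℕ-⊕ : ∀ j r → toℕ (j ⊕ r) ≡ (toℕ j + r) % n
  toℕ-⊕ j r = toℕ-fromℕ< _

  %-absorbˡ : ∀ a b → (a % n + b) % n ≡ (a + b) % n
  %-absorbˡ a b = begin
    (a % n + b) % n           ≡⟨ %-distribˡ-+ (a % n) b n ⟩
    (a % n % n + b % n) % n   ≡⟨ cong (λ x → (x + b % n) % n) (m%n%n≡m%n a n) ⟩
    (a % n + b % n) % n       ≡⟨ %-distribˡ-+ a b n ⟨
    (a + b) % n               ∎

  ⊕-≡ : ∀ j r {i} → (toℕ j + r) % n ≡ toℕ i → j ⊕ r ≡ i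
  ⊕-≡ j r eq = toℕ-injective (trans (toℕ-⊕ j r) eq)

  ⊕-assoc : ∀ j r s → j ⊕ r ⊕ s ≡ j ⊕ (r + s)
  ⊕-assoc j r s = ⊕-≡ (j ⊕ r) s (begin
    (toℕ (j ⊕ r) + s) % n     ≡⟨ cong (λ x → (x + s) % n) (toℕ-⊕ j r) ⟩
    ((toℕ j + r) % n + s) % n ≡⟨ %-absorbˡ (toℕ j + r) s ⟩
    (toℕ j + r + s) % n       ≡⟨ cong (_% n) (+-assoc (toℕ j) r s) ⟩
    (toℕ j + (r + s)) % n     ≡⟨ toℕ-⊕ j (r + s) ⟨
    toℕ (j ⊕ (r + s))         ∎)

  ⊕-identity : ∀ j → j ⊕ 0 ≡ j
  ⊕-identity j = ⊕-≡ j 0 (trans (cong (_% n) (+-identityʳ (toℕ j))) (m<n⇒m%n≡m (toℕ<n j)))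

  ⊕-period : ∀ j → j ⊕ n ≡ j
  ⊕-period j = ⊕-≡ j n (trans ([m+n]%n≡m%n (toℕ j) n) (m<n⇒m%n≡m (toℕ<n j)))

  ⊕-comm : ∀ i j → i ⊕ toℕ j ≡ j ⊕ toℕ i
  ⊕-comm i j = cong (_mod n) (+-comm (toℕ i) (toℕ j))

  ⊕-rewind : ∀ j {r} → r < n → toℕ (j ⊕ r ⊕ (n ∸ toℕ j)) ≡ r
  ⊕-rewind j {r} r<n = begin
    toℕ (j ⊕ r ⊕ (n ∸ toℕ j))            ≡⟨ cong toℕ (⊕-assoc j r (n ∸ toℕ j)) ⟩
    toℕ (j ⊕ (r + (n ∸ toℕ j)))          ≡⟨ toℕ-⊕ j (r + (n ∸ toℕ j)) ⟩
    (toℕ j + (r + (n ∸ toℕ j))) % n      ≡⟨ cong (_% n) (+-comm (toℕ j) _) ⟩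
    (r + (n ∸ toℕ j) + toℕ j) % n        ≡⟨ cong (_% n) (+-assoc r _ _) ⟩
    (r + (n ∸ toℕ j + toℕ j)) % n        ≡⟨ cong (λ x → (r + x) % n) (m∸n+n≡m (<⇒≤ (toℕ<n j))) ⟩
    (r + n) % n                          ≡⟨ [m+n]%n≡m%n r n ⟩
    r % n                                ≡⟨ m<n⇒m%n≡m r<n ⟩
    r                                    ∎

  ⊕-cancel : ∀ j {r s} → r < n → s < n → j ⊕ r ≡ j ⊕ s → r ≡ s
  ⊕-cancel j {r} {s} r<n s<n eq = begin
    r                            ≡⟨ ⊕-rewind j r<n ⟨
    toℕ (j ⊕ r ⊕ (n ∸ toℕ j))    ≡⟨ cong (λ x → toℕ (x ⊕ (n ∸ toℕ j))) eq ⟩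
    toℕ (j ⊕ s ⊕ (n ∸ toℕ j))    ≡⟨ ⊕-rewind j s<n ⟩
    s                            ∎

  -- i ⊖ j is the residue of i - j: the number of steps from j forward to i.
  _⊖_ : Fin n → Fin n → Fin n
  i ⊖ j = i ⊕ (n ∸ toℕ j)

  ⊕-⊖ : ∀ i j → j ⊕ toℕ (i ⊖ j) ≡ i
  ⊕-⊖ i j = begin
    j ⊕ toℕ (i ⊖ j)         ≡⟨ ⊕-comm j (i ⊖ j) ⟩
    i ⊕ (n ∸ toℕ j) ⊕ toℕ j ≡⟨ ⊕-assoc i (n ∸ toℕ j) (toℕ j) ⟩
    i ⊕ (n ∸ toℕ j + toℕ j) ≡⟨ cong (i ⊕_) (m∸n+n≡m (<⇒≤ (toℕ<n j))) ⟩
    i ⊕ n                   ≡⟨ ⊕-period i ⟩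
    i                       ∎

  ⊖-unique : ∀ i j {r} → r < n → j ⊕ r ≡ i → toℕ (i ⊖ j) ≡ r
  ⊖-unique i j r<n eq = ⊕-cancel j (toℕ<n (i ⊖ j)) r<n (trans (⊕-⊖ i j) (sym eq))

  ⊖-self : ∀ i → toℕ (i ⊖ i) ≡ 0
  ⊖-self i = ⊖-unique i i (>-nonZero⁻¹ n) (⊕-identity i)

  ⊖-involutive : ∀ i x → i ⊖ (i ⊖ x) ≡ x
  ⊖-involutive i x =
    toℕ-injective (⊖-unique i (i ⊖ x) (toℕ<n x) (trans (⊕-comm (i ⊖ x) x) (⊕-⊖ i x)))

  ⊕-⊖-cancel : ∀ j y → (j ⊕ toℕ y) ⊖ j ≡ y
  ⊕-⊖-cancel j y = toℕ-injective (⊖-unique (j ⊕ toℕ y) j (toℕ<n y) refl)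

  ⊖-triangle : ∀ i x j → toℕ (i ⊖ x) + toℕ (x ⊖ j) < n →
               toℕ (i ⊖ j) ≡ toℕ (i ⊖ x) + toℕ (x ⊖ j)
  ⊖-triangle i x j bound = ⊖-unique i j bound (begin
    j ⊕ (toℕ (i ⊖ x) + toℕ (x ⊖ j)) ≡⟨ cong (j ⊕_) (+-comm (toℕ (i ⊖ x)) _) ⟩
    j ⊕ (toℕ (x ⊖ j) + toℕ (i ⊖ x)) ≡⟨ ⊕-assoc j _ _ ⟨
    j ⊕ toℕ (x ⊖ j) ⊕ toℕ (i ⊖ x)   ≡⟨ cong (_⊕ toℕ (i ⊖ x)) (⊕-⊖ x j) ⟩
    x ⊕ toℕ (i ⊖ x)                 ≡⟨ ⊕-⊖ i x ⟩
    i                               ∎)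

  ⊖-≤ : ∀ i j → toℕ j ≤ toℕ i → toℕ (i ⊖ j) ≡ toℕ i ∸ toℕ j
  ⊖-≤ i j j≤i = ⊖-unique i j (≤-<-trans (m∸n≤m (toℕ i) (toℕ j)) (toℕ<n i))
    (⊕-≡ j _ (trans (cong (_% n) (m+[n∸m]≡n j≤i)) (m<n⇒m%n≡m (toℕ<n i))))

  ⊖-> : ∀ i j → toℕ i < toℕ j → toℕ (i ⊖ j) ≡ toℕ i + n ∸ toℕ j
  ⊖-> i j i<j = ⊖-unique i j wrapped<n
    (⊕-≡ j _ (trans (cong (_% n) (m+[n∸m]≡n j≤i+n))
                    (trans ([m+n]%n≡m%n (toℕ i) n) (m<n⇒m%n≡m (toℕ<n i)))))
    where
    j≤i+n : toℕ j ≤ toℕ i + n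
    j≤i+n = ≤-trans (<⇒≤ (toℕ<n j)) (m≤n+m n (toℕ i))
    wrapped<n : toℕ i + n ∸ toℕ j < n
    wrapped<n = m<n+o⇒m∸n<o (toℕ i + n) (toℕ j) (+-monoˡ-< n i<j)

  pred<n : pred n < n
  pred<n = subst (pred n <_) (suc-pred n) (n<1+n (pred n))

  arcTo? : ∀ c i → Decidable (λ x → toℕ (i ⊖ x) < c)
  arcTo? c i x = toℕ (i ⊖ x) <? c
  arcFrom? : ∀ c j → Decidable (λ x → toℕ (x ⊖ j) < c)
  arcFrom? c j x = toℕ (x ⊖ j) <? c

  arcTo arcFrom : ℕ → Fin n → Subset n
  arcTo   c i = ⟦ arcTo? c i ⟧
  arcFrom c j = ⟦ arcFrom? c j ⟧

  -- An arc of length c ≤ n has c points: x ↦ i ⊖ x and x ↦ x ⊖ j are permutations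
  -- carrying the arcs onto the initial segment {y : y < c}.
  ∣arcTo∣ : ∀ {c} i → c ≤ n → ∣ arcTo c i ∣ ≡ c
  ∣arcTo∣ i c≤n = trans (∣tabulate∣-permute _ reflection) (∣⟦<⟧∣ c≤n)
    where
    reflection : Permutation′ n
    reflection = permutation (i ⊖_) (i ⊖_) (⊖-involutive i) (⊖-involutive i)

  ∣arcFrom∣ : ∀ {c} j → c ≤ n → ∣ arcFrom c j ∣ ≡ c
  ∣arcFrom∣ j c≤n = trans (∣tabulate∣-permute _ rotation) (∣⟦<⟧∣ c≤n)
    where
    rotation : Permutation′ n
    rotation = permutation (_⊖ j) (λ y → j ⊕ toℕ y) (⊕-⊖-cancel j) (λ x → ⊕-⊖ x j)

  -- A proper nonempty arc determines its end point: the successor of i leaves arcTo c i,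
  -- but it would stay in arcTo c i′ for any other end point i′ of an arc containing i.
  arcTo-injective : ∀ {c} → 0 < c → c < n → Injective _≡_ _≡_ (arcTo c)
  arcTo-injective {c} 0<c c<n {i} {i′} same = endpoint (toℕ (i′ ⊖ i)) refl
    where
    i∈arc-i′ : toℕ (i′ ⊖ i) < c
    i∈arc-i′ = ⟦⟧-⊆ (arcTo? c i) (arcTo? c i′) same i (subst (_< c) (sym (⊖-self i)) 0<c)
    endpoint : ∀ d → toℕ (i′ ⊖ i) ≡ d → i ≡ i′
    endpoint zero    i′⊖i≡0 = begin
      i                   ≡⟨ ⊕-identity i ⟨
      i ⊕ 0               ≡⟨ cong (i ⊕_) i′⊖i≡0 ⟨
      i ⊕ toℕ (i′ ⊖ i)    ≡⟨ ⊕-⊖ i′ i ⟩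
      i′                  ∎
    endpoint (suc d) i′⊖i≡1+d =
      ⊥-elim (<⇒≱ (⟦⟧-⊆ (arcTo? c i′) (arcTo? c i) (sym same) succ succ∈arc-i′)
                  (subst (c ≤_) (sym i⊖succ≡pred) (suc[m]≤n⇒m≤pred[n] c<n)))
      where
      succ = i ⊕ 1
      d<c : d < c
      d<c = <-trans (n<1+n d) (subst (_< c) i′⊖i≡1+d i∈arc-i′)
      succ⊕d≡i′ : succ ⊕ d ≡ i′
      succ⊕d≡i′ = begin
        i ⊕ 1 ⊕ d          ≡⟨ ⊕-assoc i 1 d ⟩
        i ⊕ suc d          ≡⟨ cong (i ⊕_) i′⊖i≡1+d ⟨
        i ⊕ toℕ (i′ ⊖ i)   ≡⟨ ⊕-⊖ i′ i ⟩
        i′                 ∎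
      succ⊕pred≡i : succ ⊕ pred n ≡ i
      succ⊕pred≡i = begin
        i ⊕ 1 ⊕ pred n     ≡⟨ ⊕-assoc i 1 (pred n) ⟩
        i ⊕ suc (pred n)   ≡⟨ cong (i ⊕_) (suc-pred n) ⟩
        i ⊕ n              ≡⟨ ⊕-period i ⟩
        i                  ∎
      succ∈arc-i′ : toℕ (i′ ⊖ succ) < c
      succ∈arc-i′ = subst (_< c) (sym (⊖-unique i′ succ (<-trans d<c c<n) succ⊕d≡i′)) d<c
      i⊖succ≡pred : toℕ (i ⊖ succ) ≡ pred n
      i⊖succ≡pred = ⊖-unique i succ pred<n succ⊕pred≡i

  -- Symmetrically, a proper nonempty arc determines its start point (via the predecessor of j).
  arcFrom-injective : ∀ {c} → 0 < c → c < n → Injective _≡_ _≡_ (arcFrom c)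
  arcFrom-injective {c} 0<c c<n {j} {j′} same = startpoint (toℕ (j ⊖ j′)) refl
    where
    j∈arc-j′ : toℕ (j ⊖ j′) < c
    j∈arc-j′ = ⟦⟧-⊆ (arcFrom? c j) (arcFrom? c j′) same j (subst (_< c) (sym (⊖-self j)) 0<c)
    startpoint : ∀ d → toℕ (j ⊖ j′) ≡ d → j ≡ j′
    startpoint zero    j⊖j′≡0 = begin
      j                   ≡⟨ ⊕-⊖ j j′ ⟨
      j′ ⊕ toℕ (j ⊖ j′)   ≡⟨ cong (j′ ⊕_) j⊖j′≡0 ⟩
      j′ ⊕ 0              ≡⟨ ⊕-identity j′ ⟩
      j′                  ∎
    startpoint (suc d) j⊖j′≡1+d =
      ⊥-elim (<⇒≱ (⟦⟧-⊆ (arcFrom? c j′) (arcFrom? c j) (sym same) prev prev∈arc-j′)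
                  (subst (c ≤_) (sym prev⊖j≡pred) (suc[m]≤n⇒m≤pred[n] c<n)))
      where
      prev = j ⊕ pred n
      d<c : d < c
      d<c = <-trans (n<1+n d) (subst (_< c) j⊖j′≡1+d j∈arc-j′)
      j′⊕d≡prev : j′ ⊕ d ≡ prev
      j′⊕d≡prev = begin
        j′ ⊕ d                      ≡⟨ ⊕-period (j′ ⊕ d) ⟨
        j′ ⊕ d ⊕ n                  ≡⟨ ⊕-assoc j′ d n ⟩
        j′ ⊕ (d + n)                ≡⟨ cong (λ y → j′ ⊕ (d + y)) (suc-pred n) ⟨
        j′ ⊕ (d + suc (pred n))     ≡⟨ cong (j′ ⊕_) (+-suc d (pred n)) ⟩
        j′ ⊕ (suc d + pred n)       ≡⟨ ⊕-assoc j′ (suc d) (pred n) ⟨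
        j′ ⊕ suc d ⊕ pred n         ≡⟨ cong (λ y → j′ ⊕ y ⊕ pred n) j⊖j′≡1+d ⟨
        j′ ⊕ toℕ (j ⊖ j′) ⊕ pred n  ≡⟨ cong (_⊕ pred n) (⊕-⊖ j j′) ⟩
        prev                        ∎
      prev∈arc-j′ : toℕ (prev ⊖ j′) < c
      prev∈arc-j′ = subst (_< c) (sym (⊖-unique prev j′ (<-trans d<c c<n) j′⊕d≡prev)) d<c
      prev⊖j≡pred : toℕ (prev ⊖ j) ≡ pred n
      prev⊖j≡pred = ⊖-unique prev j pred<n refl

  arcs-meet : ∀ {a b} i j → a + b < n →
              Nonempty (arcTo (suc a) i ∩ arcFrom (suc b) j) ⇔ toℕ (i ⊖ j) < suc (a + b)
  arcs-meet {a} {b} i j a+b<n = mk⇔ meet⇒ meet⇐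
    where
    meet⇒ : Nonempty (arcTo (suc a) i ∩ arcFrom (suc b) j) → toℕ (i ⊖ j) < suc (a + b)
    meet⇒ (x , x∈) with x∈p∩q⁻ (arcTo (suc a) i) (arcFrom (suc b) j) x∈
    ... | x∈arcTo , x∈arcFrom
      with Equivalence.to (∈⟦⟧ (arcTo? (suc a) i) x) x∈arcTo
         | Equivalence.to (∈⟦⟧ (arcFrom? (suc b) j) x) x∈arcFrom
    ... | s≤s i⊖x≤a | s≤s x⊖j≤b =
      s≤s (subst (_≤ a + b) (sym (⊖-triangle i x j (≤-<-trans steps≤a+b a+b<n))) steps≤a+b)
      where
      steps≤a+b = +-mono-≤ i⊖x≤a x⊖j≤b
    meet⇐ : toℕ (i ⊖ j) < suc (a + b) → Nonempty (arcTo (suc a) i ∩ arcFrom (suc b) j)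
    meet⇐ (s≤s i⊖j≤a+b) with splitBelow a b i⊖j≤a+b
    ... | u , v , u≤a , v≤b , u+v≡i⊖j =
      x , x∈p∩q⁺ (Equivalence.from (∈⟦⟧ (arcTo? (suc a) i) x) (s≤s (subst (_≤ a) (sym i⊖x≡u) u≤a)) ,
                  Equivalence.from (∈⟦⟧ (arcFrom? (suc b) j) x) (s≤s (subst (_≤ b) (sym x⊖j≡v) v≤b)))
      where
      -- x is v steps after j, hence u steps before i
      x = j ⊕ v
      x⊖j≡v : toℕ (x ⊖ j) ≡ v
      x⊖j≡v = ⊖-unique x j (≤-<-trans (≤-trans v≤b (m≤n+m b a)) a+b<n) refl
      i⊖x≡u : toℕ (i ⊖ x) ≡ u
      i⊖x≡u = ⊖-unique i x (≤-<-trans (≤-trans u≤a (m≤m+n a b)) a+b<n) (begin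
        j ⊕ v ⊕ u        ≡⟨ ⊕-assoc j v u ⟩
        j ⊕ (v + u)      ≡⟨ cong (j ⊕_) (trans (+-comm v u) u+v≡i⊖j) ⟩
        j ⊕ toℕ (i ⊖ j)  ≡⟨ ⊕-⊖ i j ⟩
        i                ∎)

  -- Arcs of a+1 and b+1 points realize the pattern "i ⊖ j ≤ a + b" over Fin n,
  -- as long as a + b + 1 < n (so that no arc is the whole cycle).
  arcRealization : ∀ a b → suc (a + b) < n →
                   Realization n n n (λ i j → toℕ (i ⊖ j) < suc (a + b)) (suc a) (suc b)
  arcRealization a b a+b+1<n =
    arcTo (suc a) , arcFrom (suc b) ,
    ((λ i → ∣arcTo∣ i (<⇒≤ 1+a<n)) , arcTo-injective z<s 1+a<n) ,
    ((λ j → ∣arcFrom∣ j (<⇒≤ 1+b<n)) , arcFrom-injective z<s 1+b<n) ,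
    λ i j → ⇔-sym (arcs-meet i j (<-trans (n<1+n (a + b)) a+b+1<n))
    where
    1+a<n = ≤-<-trans (s≤s (m≤m+n a b)) a+b+1<n
    1+b<n = ≤-<-trans (s≤s (m≤n+m b a)) a+b+1<n

module _ {p q : ℕ} {{_ : NonZero (p + q)}} where
  open Cyclic (p + q)

  C⇔⊖ : (i j : Fin (p + q)) → C p q i j ⇔ toℕ (i ⊖ j) < p
  C⇔⊖ i j with toℕ j ≤? toℕ i
  ... | yes j≤i = mk⇔ (λ { (inj₁ (_ , i∸j<p)) → subst (_< p) (sym (⊖-≤ i j j≤i)) i∸j<p
                          ; (inj₂ (i<j , _))   → ⊥-elim (<⇒≱ i<j j≤i) })
                      (λ i⊖j<p → inj₁ (j≤i , subst (_< p) (⊖-≤ i j j≤i) i⊖j<p))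
  ... | no j≰i = mk⇔ (λ { (inj₁ (j≤i , _))     → ⊥-elim (j≰i j≤i)
                         ; (inj₂ (_ , i+n∸j<p)) → subst (_< p) (sym (⊖-> i j i<j)) i+n∸j<p })
                     (λ i⊖j<p → inj₂ (i<j , subst (_< p) (⊖-> i j i<j) i⊖j<p))
    where
    i<j = ≰⇒> j≰i

circulantRealization : ∀ a b q → 0 < q →
  Realization (suc (a + b) + q) (suc (a + b) + q) (suc (a + b) + q) (C (suc (a + b)) q) (suc a) (suc b)
circulantRealization a b q 0<q =
  Realization-cong C⇔⊖ (arcRealization a b (m<m+n (suc (a + b)) 0<q))
  where open Cyclic (suc (a + b) + q)

-- Padding the arcs to t′ + 1 points each costs (t′ - a) + (t′ - b) extra points, so the whole
-- construction uses q + 2t′ + 1 points of [k].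
circulantSubmatrix : ∀ {k t′ a b} q → 0 < q → a ≤ t′ → b ≤ t′ → suc (q + (t′ + t′)) ≤ k →
  IsSubmatrixOfA k (suc t′) (suc (a + b) + q) (suc (a + b) + q) (C (suc (a + b)) q)
circulantSubmatrix {k} {t′} {a} {b} q 0<q a≤t′ b≤t′ room =
  subst (λ k → IsSubmatrixOfA k (suc t′) len len (C (suc (a + b)) q)) (m+[n∸m]≡n len≤k)
    (pad paddings≤rest (cong suc (m+[n∸m]≡n a≤t′)) (cong suc (m+[n∸m]≡n b≤t′))
         (circulantRealization a b q 0<q))
  where
  len = suc (a + b) + q
  paddings = (t′ ∸ a) + (t′ ∸ b)
  regroup : ∀ u v w x y → suc (u + v) + w + (x + y) ≡ suc (w + ((u + x) + (v + y)))
  regroup = solve-∀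
  total : len + paddings ≡ suc (q + (t′ + t′))
  total = trans (regroup a b q (t′ ∸ a) (t′ ∸ b))
                (cong (λ z → suc (q + z)) (cong₂ _+_ (m+[n∸m]≡n a≤t′) (m+[n∸m]≡n b≤t′)))
  len+paddings≤k : len + paddings ≤ k
  len+paddings≤k = subst (_≤ k) (sym total) room
  len≤k : len ≤ k
  len≤k = m+n≤o⇒m≤o len len+paddings≤k
  paddings≤rest : paddings ≤ k ∸ len
  paddings≤rest = m+n≤o⇒m≤o∸n paddings (subst (_≤ k) (+-comm len paddings) len+paddings≤k)

p≤2t∸1⇒p′≤t′+t′ : ∀ {p′ t′} → suc p′ ≤ 2 * suc t′ ∸ 1 → p′ ≤ t′ + t′
p≤2t∸1⇒p′≤t′+t′ {p′} {t′} p≤2t∸1 =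
  s≤s⁻¹ (subst (suc p′ ≤_) 2t∸1≡1+2t′ p≤2t∸1)
  where
  2t∸1≡1+2t′ : 2 * suc t′ ∸ 1 ≡ suc (t′ + t′)
  2t∸1≡1+2t′ = trans (+-suc t′ (t′ + 0)) (cong (λ z → suc (t′ + z)) (+-identityʳ t′))

room : ∀ {k t′ q} → 2 * suc t′ ≤ k → q ≤ suc (k ∸ 2 * suc t′) → suc (q + (t′ + t′)) ≤ k
room {k} {t′} {q} 2t≤k q≤1+k∸2t = s≤s⁻¹ (begin
  suc (suc (q + (t′ + t′)))          ≡⟨ regroup q t′ ⟩
  q + 2 * suc t′                     ≤⟨ +-monoˡ-≤ (2 * suc t′) q≤1+k∸2t ⟩
  suc (k ∸ 2 * suc t′) + 2 * suc t′  ≡⟨ cong suc (m∸n+n≡m 2t≤k) ⟩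
  suc k                              ∎)
  where
  open ≤-Reasoning
  regroup : ∀ w x → suc (suc (w + (x + x))) ≡ w + 2 * suc x
  regroup = solve-∀

theorem1 : (k t p q : ℕ) → 1 ≤ t → 2 * t ≤ k → 1 ≤ p → p ≤ 2 * t ∸ 1 → 1 ≤ q → q ≤ suc (k ∸ 2 * t) →
    IsSubmatrixOfA k t (p + q) (p + q) (C p q)
theorem1 k (suc t′) (suc p′) q (s≤s z≤n) 2t≤k (s≤s z≤n) p≤2t∸1 0<q q≤1+k∸2t
  with splitBelow t′ t′ (p≤2t∸1⇒p′≤t′+t′ p≤2t∸1)
... | a , b , a≤t′ , b≤t′ , refl = circulantSubmatrix q 0<q a≤t′ b≤t′ (room 2t≤k q≤1+k∸2t)
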